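{- Let $M$ be a connected matroid of rank $3$ on $E$ with rank function $r$, and let $A\subseteq E$ be a flat with $r(A)=1$. Then $(A,1)_\le$ is a facet-defining inequality of $\mathcal{B}(M)$ if and only if there is no pair of flats $F_1,F_2$ of $M$ of rank $2$ with $A=F_1\cap F_2$ and $F_1\cup F_2=E$.
   Context: $(A,a)_\le=\{I\subseteq E:|I\cap A|\le a\}$, $(A,a)_==\{I\subseteq E:|I\cap A|=a\}$. $\mathcal{B}(M)$ is the family of bases. A face of $\mathcal{B}(M)$ is $\mathcal{B}(M)\cap\bigcap_i(A_i,r(A_i))_=$; a facet is a maximal proper face; $(A,r(A))_\le$ is facet-defining if $\mathcal{B}(M)\cap(A,r(A))_=$ is a facet. -}

module Defs where

open import Data.Nat using (ℕ; zero; suc; _≤_; _<_; _⊔_)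
open import Data.Bool using (Bool; true; false)
open import Data.Vec using (_∷_; [])
open import Data.List using (List; []; _∷_; map; filter; foldr; _++_)
open import Data.List.Relation.Unary.All using (All)
open import Data.Fin using (Fin)
open import Data.Fin.Subset using (Subset; _∈_; _∉_; _⊆_; _⊂_; _∩_; _∪_; ⁅_⁆; ∣_∣; ⊤; inside; outside)
open import Data.Fin.Subset.Properties using (_⊆?_)
open import Data.Product using (Σ; _×_; _,_; ∃-syntax)
open import Relation.Nullary using (¬_; Dec)
open import Relation.Nullary.Decidable using (_×-dec_)
open import Relation.Unary using (Decidable)
open import Relation.Binary.PropositionalEquality using (_≡_; _≢_)

-- A matroid on the ground set E = Fin n, given by its independent sets
-- (independence is decidable; every finite matroid is of this form classically).
record Matroid (n : ℕ) : Set₁ where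
  field
    Indep    : Subset n → Set
    indep?   : Decidable Indep
    I1-empty : Indep (Data.Fin.Subset.⊥)
    I2-down  : ∀ {X Y} → Indep Y → X ⊆ Y → Indep X
    I3-aug   : ∀ {X Y} → Indep X → Indep Y → ∣ X ∣ < ∣ Y ∣ →
               ∃[ e ] (e ∈ Y × e ∉ X × Indep (X ∪ ⁅ e ⁆))

allSubsets : (n : ℕ) → List (Subset n)
allSubsets zero = [] ∷ []
allSubsets (suc n) = map (outside ∷_) (allSubsets n) ++ map (inside ∷_) (allSubsets n)

maxList : List ℕ → ℕ
maxList = foldr _⊔_ 0

module _ {n : ℕ} (M : Matroid n) where
  open Matroid M

  rank : Subset n → ℕ
  rank A = maxList (map ∣_∣ (filter (λ X → (X ⊆? A) ×-dec indep? X) (allSubsets n)))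

  IsBase : Subset n → Set
  IsBase X = Indep X × (∀ Y → Indep Y → X ⊆ Y → Y ≡ X)

  IsCircuit : Subset n → Set
  IsCircuit C = ¬ Indep C × (∀ D → D ⊂ C → Indep D)

  Connected : Set
  Connected = ∀ (e f : Fin n) → e ≢ f → ∃[ C ] (IsCircuit C × e ∈ C × f ∈ C)

  IsFlat : Subset n → Set
  IsFlat A = ∀ e → e ∉ A → rank A < rank (A ∪ ⁅ e ⁆)

  -- families of subsets of E (predicates); here families of bases
  Family : Set₁
  Family = Subset n → Set

  _⊆ᶠ_ : Family → Family → Set
  F ⊆ᶠ G = ∀ X → F X → G X

  -- the face B(M) ∩ ⋂_{A ∈ As} (A, r(A))_=
  Face : List (Subset n) → Family
  Face As X = IsBase X × All (λ A → ∣ X ∩ A ∣ ≡ rank A) As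

  -- a face F is proper iff F ≠ B(M) (faces are always contained in B(M))
  Proper : Family → Set
  Proper F = ¬ (IsBase ⊆ᶠ F)

  IsFacet : Family → Set
  IsFacet F = (∃[ As ] (F ⊆ᶠ Face As × Face As ⊆ᶠ F))
            × Proper F
            × (∀ Bs → Proper (Face Bs) → F ⊆ᶠ Face Bs → Face Bs ⊆ᶠ F)

  -- (A, r(A))_≤ is facet-defining iff B(M) ∩ (A, r(A))_= is a facet
  FacetDefining : Subset n → Set
  FacetDefining A = IsFacet (Face (A ∷ []))

module Submission where

-- Connectivity yields a base avoiding A, so
-- the face B(M) ∩ (A,1)_= is proper.
--   (⇒) If lines F₁, F₂ split E with F₁ ∩ F₂ = A, inclusion–exclusion gives
--       |B ∩ F₁| + |B ∩ F₂| = 3 + |B ∩ A| for every base B; hence the face of A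
--       lies in the proper faces of F₁ and F₂, and every base lies in one of the
--       three faces.  Maximality would then put every base in the face of A.
--   (⇐) If no such pair exists, any two lines cl{a,y}, cl{a,z} (y,z ∉ A) miss a
--       common point x, and the bases {a,x,y}, {a,x,z} of the face of A show
--       that a set S tight on that face contains either all or none of E ∖ A.
--       So S is tight on every base as soon as it is tight on one base avoiding
--       A, which forces every larger proper face to equal the face of A.

open import Defs
open import Data.Nat using (ℕ; zero; suc; _+_; _∸_; _≤_; _<_; z≤n; s≤s; _≤?_)
open import Data.Nat.Properties
open import Data.Vec using ([]; _∷_; here; there; tabulate)
open import Data.Vec.Properties using (lookup∘tabulate; []=⇒lookup; lookup⇒[]=)
open import Data.List using ([]; _∷_; map; filter)
open import Data.List.Membership.Propositional as List using ()
open import Data.List.Membership.Propositional.Properties using (∈-++⁺ˡ; ∈-++⁺ʳ; ∈-map⁺; ∈-map⁻; ∈-filter⁺; ∈-filter⁻)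
open import Data.List.Relation.Unary.Any using (here; there)
import Data.List.Relation.Unary.All as All
open import Data.Fin using (Fin; zero; suc) renaming (_≟_ to _≟ᶠ_)
open import Data.Fin.Subset
open import Data.Fin.Subset.Properties
open import Data.Fin.Properties using (any?)
open import Data.Product using (_×_; _,_; ∃-syntax; proj₁; proj₂)
open import Data.Sum using (_⊎_; inj₁; inj₂)
open import Data.Empty using (⊥-elim)
open import Relation.Nullary using (¬_; yes; no; does; ¬?)
open import Relation.Nullary.Decidable using (_×-dec_; dec-true)
open import Relation.Unary using (Pred; Decidable)
open import Relation.Binary.PropositionalEquality using (_≡_; _≢_; refl; sym; trans; cong; cong₂; subst; subst₂; module ≡-Reasoning)
open import Function.Bundles using (_⇔_; mk⇔)

allSubsets-complete : ∀ {n} (X : Subset n) → X List.∈ allSubsets n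
allSubsets-complete [] = here refl
allSubsets-complete {suc n} (outside ∷ X) =
  ∈-++⁺ˡ (∈-map⁺ (outside ∷_) (allSubsets-complete X))
allSubsets-complete {suc n} (inside ∷ X) =
  ∈-++⁺ʳ (map (outside ∷_) (allSubsets n)) (∈-map⁺ (inside ∷_) (allSubsets-complete X))

maxList-upper : ∀ {x} xs → x List.∈ xs → x ≤ maxList xs
maxList-upper (y ∷ ys) (here refl) = m≤m⊔n y (maxList ys)
maxList-upper (y ∷ ys) (there x∈) = ≤-trans (maxList-upper ys x∈) (m≤n⊔m y (maxList ys))

maxList-attained : ∀ xs → maxList xs ≡ 0 ⊎ maxList xs List.∈ xs
maxList-attained [] = inj₁ refl
maxList-attained (y ∷ ys) with ⊔-sel y (maxList ys)
... | inj₁ max≡y = inj₂ (here max≡y)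
... | inj₂ max≡m with maxList-attained ys
...   | inj₁ m≡0 = inj₁ (trans max≡m m≡0)
...   | inj₂ m∈ = inj₂ (there (subst (List._∈ ys) (sym max≡m) m∈))

select : ∀ {n ℓ} {P : Pred (Fin n) ℓ} → Decidable P → Subset n
select P? = tabulate (λ x → does (P? x))

∈-select⁺ : ∀ {n ℓ} {P : Pred (Fin n) ℓ} (P? : Decidable P) {x} → P x → x ∈ select P?
∈-select⁺ P? {x} px =
  lookup⇒[]= x (select P?) (trans (lookup∘tabulate _ x) (dec-true (P? x) px))

∈-select⁻ : ∀ {n ℓ} {P : Pred (Fin n) ℓ} (P? : Decidable P) {x} → x ∈ select P? → P x
∈-select⁻ P? {x} x∈ with P? x | trans (sym (lookup∘tabulate (λ y → does (P? y)) x)) ([]=⇒lookup x∈)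
... | yes px | _ = px
... | no _ | ()

∪-least : ∀ {n} {P Q R : Subset n} → P ⊆ R → Q ⊆ R → P ∪ Q ⊆ R
∪-least {P = P} {Q} P⊆R Q⊆R x∈ with x∈p∪q⁻ P Q x∈
... | inj₁ x∈P = P⊆R x∈P
... | inj₂ x∈Q = Q⊆R x∈Q

⁅⁆-⊆ : ∀ {n} {x : Fin n} {R : Subset n} → x ∈ R → ⁅ x ⁆ ⊆ R
⁅⁆-⊆ {x = x} {R} x∈R y∈ = subst (_∈ R) (sym (x∈⁅y⁆⇒x≡y x y∈)) x∈R

insert-⊆ : ∀ {n} {P R : Subset n} {x} → P ⊆ R → x ∈ R → P ∪ ⁅ x ⁆ ⊆ R
insert-⊆ P⊆R x∈R = ∪-least P⊆R (⁅⁆-⊆ x∈R)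

pair-⊆ : ∀ {n} {x y : Fin n} {R : Subset n} → x ∈ R → y ∈ R → ⁅ x ⁆ ∪ ⁅ y ⁆ ⊆ R
pair-⊆ x∈R y∈R = insert-⊆ (⁅⁆-⊆ x∈R) y∈R

∈-insert-new : ∀ {n} (P : Subset n) (x : Fin n) → x ∈ P ∪ ⁅ x ⁆
∈-insert-new P x = x∈p∪q⁺ (inj₂ (x∈⁅x⁆ x))

∈-insert-old : ∀ {n} {P : Subset n} {y} (x : Fin n) → y ∈ P → y ∈ P ∪ ⁅ x ⁆
∈-insert-old x y∈P = x∈p∪q⁺ (inj₁ y∈P)

∉-pair : ∀ {n} {x y z : Fin n} → z ≢ x → z ≢ y → z ∉ ⁅ x ⁆ ∪ ⁅ y ⁆
∉-pair {x = x} {y} {z} z≢x z≢y z∈ with x∈p∪q⁻ ⁅ x ⁆ ⁅ y ⁆ z∈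
... | inj₁ z∈x = z≢x (x∈⁅y⁆⇒x≡y x z∈x)
... | inj₂ z∈y = z≢y (x∈⁅y⁆⇒x≡y y z∈y)

∉-remove : ∀ {n} (p : Subset n) (x : Fin n) → x ∉ p - x
∉-remove (_ ∷ p) zero ()
∉-remove (_ ∷ p) (suc x) (there x∈) = ∉-remove p x x∈

∈-remove⁻ : ∀ {n} {C : Subset n} {p q} → q ∈ C - p → q ∈ C × q ≢ p
∈-remove⁻ {C = C} {p} q∈ = p─q⊆p C ⁅ p ⁆ q∈ , λ { refl → ∉-remove C p q∈ }

remove-⊆ : ∀ {n} {C X : Subset n} {p} → (∀ {q} → q ∈ C → q ≢ p → q ∈ X) → C - p ⊆ X
remove-⊆ others∈X q∈ = let (q∈C , q≢p) = ∈-remove⁻ q∈ in others∈X q∈C q≢p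

insert-comm : ∀ {n} (Q : Subset n) (x y : Fin n) → (Q ∪ ⁅ y ⁆) ∪ ⁅ x ⁆ ≡ (Q ∪ ⁅ x ⁆) ∪ ⁅ y ⁆
insert-comm Q x y = begin
  (Q ∪ ⁅ y ⁆) ∪ ⁅ x ⁆ ≡⟨ ∪-assoc Q ⁅ y ⁆ ⁅ x ⁆ ⟩
  Q ∪ (⁅ y ⁆ ∪ ⁅ x ⁆) ≡⟨ cong (Q ∪_) (∪-comm ⁅ y ⁆ ⁅ x ⁆) ⟩
  Q ∪ (⁅ x ⁆ ∪ ⁅ y ⁆) ≡⟨ ∪-assoc Q ⁅ x ⁆ ⁅ y ⁆ ⟨
  (Q ∪ ⁅ x ⁆) ∪ ⁅ y ⁆ ∎
  where open ≡-Reasoning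

⊆-by-card : ∀ {n} {p q : Subset n} → p ⊆ q → ∣ q ∣ ≤ ∣ p ∣ → q ⊆ p
⊆-by-card {p = p} {q} p⊆q ∣q∣≤∣p∣ {x} x∈q with x ∈? p
... | yes x∈p = x∈p
... | no x∉p = ⊥-elim (<⇒≱ (p⊂q⇒∣p∣<∣q∣ (p⊆q , x , x∈q , x∉p)) ∣q∣≤∣p∣)

card-antisym : ∀ {n} {p q : Subset n} → p ⊆ q → ∣ q ∣ ≤ ∣ p ∣ → q ≡ p
card-antisym p⊆q ∣q∣≤∣p∣ = ⊆-antisym (⊆-by-card p⊆q ∣q∣≤∣p∣) p⊆q

∉-witness : ∀ {n} {p q : Subset n} → ¬ (q ⊆ p) → ∃[ x ] (x ∈ q × x ∉ p)
∉-witness {p = p} {q} q⊈p with any? (λ x → (x ∈? q) ×-dec (¬? (x ∈? p)))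
... | yes w = w
... | no none = ⊥-elim (q⊈p q⊆p)
  where
  q⊆p : q ⊆ p
  q⊆p {x} x∈q with x ∈? p
  ... | yes x∈p = x∈p
  ... | no x∉p = ⊥-elim (none (x , x∈q , x∉p))

larger-witness : ∀ {n} {p q : Subset n} → ∣ p ∣ < ∣ q ∣ → ∃[ x ] (x ∈ q × x ∉ p)
larger-witness ∣p∣<∣q∣ = ∉-witness (λ q⊆p → <⇒≱ ∣p∣<∣q∣ (p⊆q⇒∣p∣≤∣q∣ q⊆p))

card0-∉ : ∀ {n} {p : Subset n} {x} → ∣ p ∣ ≡ 0 → x ∉ p
card0-∉ {x = x} ∣p∣≡0 x∈p = 1+n≰n (subst₂ _≤_ (∣⁅x⁆∣≡1 x) ∣p∣≡0 (p⊆q⇒∣p∣≤∣q∣ (⁅⁆-⊆ x∈p)))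

card0-empty : ∀ {n} {p : Subset n} → (∀ {x} → x ∉ p) → ∣ p ∣ ≡ 0
card0-empty {n} {p} none = trans (cong ∣_∣ (Empty-unique (λ (x , x∈) → none x∈))) (∣⊥∣≡0 n)

card-insert-∈ : ∀ {n} (Q S : Subset n) (y : Fin n) → y ∉ Q → y ∈ S →
                ∣ (Q ∪ ⁅ y ⁆) ∩ S ∣ ≡ suc ∣ Q ∩ S ∣
card-insert-∈ (outside ∷ Q) (inside ∷ S) zero y∉Q y∈S rewrite ∪-identityʳ Q = refl
card-insert-∈ (inside ∷ Q) S zero y∉Q y∈S = ⊥-elim (y∉Q here)
card-insert-∈ (inside ∷ Q) (inside ∷ S) (suc y) y∉Q (there y∈S) =
  cong suc (card-insert-∈ Q S y (λ y∈Q → y∉Q (there y∈Q)) y∈S)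
card-insert-∈ (inside ∷ Q) (outside ∷ S) (suc y) y∉Q (there y∈S) =
  card-insert-∈ Q S y (λ y∈Q → y∉Q (there y∈Q)) y∈S
card-insert-∈ (outside ∷ Q) (_ ∷ S) (suc y) y∉Q (there y∈S) =
  card-insert-∈ Q S y (λ y∈Q → y∉Q (there y∈Q)) y∈S

card-insert-∉ : ∀ {n} (Q S : Subset n) (y : Fin n) → y ∉ S → ∣ (Q ∪ ⁅ y ⁆) ∩ S ∣ ≡ ∣ Q ∩ S ∣
card-insert-∉ (_ ∷ Q) (inside ∷ S) zero y∉S = ⊥-elim (y∉S here)
card-insert-∉ (inside ∷ Q) (outside ∷ S) zero y∉S rewrite ∪-identityʳ Q = refl
card-insert-∉ (outside ∷ Q) (outside ∷ S) zero y∉S rewrite ∪-identityʳ Q = refl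
card-insert-∉ (inside ∷ Q) (inside ∷ S) (suc y) y∉S =
  cong suc (card-insert-∉ Q S y (λ y∈S → y∉S (there y∈S)))
card-insert-∉ (inside ∷ Q) (outside ∷ S) (suc y) y∉S = card-insert-∉ Q S y (λ y∈S → y∉S (there y∈S))
card-insert-∉ (outside ∷ Q) (_ ∷ S) (suc y) y∉S = card-insert-∉ Q S y (λ y∈S → y∉S (there y∈S))

card-insert : ∀ {n} (Q : Subset n) (y : Fin n) → y ∉ Q → ∣ Q ∪ ⁅ y ⁆ ∣ ≡ suc ∣ Q ∣
card-insert Q y y∉Q = begin
  ∣ Q ∪ ⁅ y ⁆ ∣         ≡⟨ cong ∣_∣ (sym (∩-identityʳ (Q ∪ ⁅ y ⁆))) ⟩
  ∣ (Q ∪ ⁅ y ⁆) ∩ ⊤ ∣   ≡⟨ card-insert-∈ Q ⊤ y y∉Q ∈⊤ ⟩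
  suc ∣ Q ∩ ⊤ ∣         ≡⟨ cong (λ Z → suc ∣ Z ∣) (∩-identityʳ Q) ⟩
  suc ∣ Q ∣             ∎
  where open ≡-Reasoning

card-⁅⁆∩-∈ : ∀ {n} (x : Fin n) (S : Subset n) → x ∈ S → ∣ ⁅ x ⁆ ∩ S ∣ ≡ 1
card-⁅⁆∩-∈ {n} x S x∈S = begin
  ∣ ⁅ x ⁆ ∩ S ∣       ≡⟨ cong (λ Z → ∣ Z ∩ S ∣) (sym (∪-identityˡ ⁅ x ⁆)) ⟩
  ∣ (⊥ ∪ ⁅ x ⁆) ∩ S ∣ ≡⟨ card-insert-∈ ⊥ S x ∉⊥ x∈S ⟩
  suc ∣ ⊥ ∩ S ∣       ≡⟨ cong (λ Z → suc ∣ Z ∣) (∩-zeroˡ S) ⟩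
  suc ∣ ⊥ {n} ∣       ≡⟨ cong suc (∣⊥∣≡0 n) ⟩
  1                   ∎
  where open ≡-Reasoning

card-⁅⁆∩-∉ : ∀ {n} (x : Fin n) (S : Subset n) → x ∉ S → ∣ ⁅ x ⁆ ∩ S ∣ ≡ 0
card-⁅⁆∩-∉ {n} x S x∉S = begin
  ∣ ⁅ x ⁆ ∩ S ∣       ≡⟨ cong (λ Z → ∣ Z ∩ S ∣) (sym (∪-identityˡ ⁅ x ⁆)) ⟩
  ∣ (⊥ ∪ ⁅ x ⁆) ∩ S ∣ ≡⟨ card-insert-∉ ⊥ S x x∉S ⟩
  ∣ ⊥ ∩ S ∣           ≡⟨ cong ∣_∣ (∩-zeroˡ S) ⟩
  ∣ ⊥ {n} ∣           ≡⟨ ∣⊥∣≡0 n ⟩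
  0                   ∎
  where open ≡-Reasoning

card-pair : ∀ {n} (x y : Fin n) → y ≢ x → ∣ ⁅ x ⁆ ∪ ⁅ y ⁆ ∣ ≡ 2
card-pair x y y≢x = trans (card-insert ⁅ x ⁆ y (x≢y⇒x∉⁅y⁆ y≢x)) (cong suc (∣⁅x⁆∣≡1 x))

inclusion-exclusion : ∀ {n} (X F G : Subset n) →
                      ∣ X ∩ F ∣ + ∣ X ∩ G ∣ ≡ ∣ X ∩ (F ∪ G) ∣ + ∣ X ∩ (F ∩ G) ∣
inclusion-exclusion [] [] [] = refl
inclusion-exclusion (outside ∷ X) (_ ∷ F) (_ ∷ G) = inclusion-exclusion X F G
inclusion-exclusion (inside ∷ X) (outside ∷ F) (outside ∷ G) = inclusion-exclusion X F G
inclusion-exclusion (inside ∷ X) (outside ∷ F) (inside ∷ G) =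
  trans (+-suc _ _) (cong suc (inclusion-exclusion X F G))
inclusion-exclusion (inside ∷ X) (inside ∷ F) (outside ∷ G) = cong suc (inclusion-exclusion X F G)
inclusion-exclusion (inside ∷ X) (inside ∷ F) (inside ∷ G) =
  cong suc (trans (+-suc _ _) (trans (cong suc (inclusion-exclusion X F G)) (sym (+-suc _ _))))

≤1-cases : ∀ {k} → k ≤ 1 → k ≡ 0 ⊎ k ≡ 1
≤1-cases z≤n = inj₁ refl
≤1-cases (s≤s z≤n) = inj₂ refl

sum≡4 : ∀ {a b} → a + b ≡ 4 → a ≤ 2 → b ≤ 2 → a ≡ 2
sum≡4 a+b≡4 z≤n b≤2 = ⊥-elim (<⇒≱ (s≤s (s≤s (s≤s z≤n))) (subst (_≤ 2) a+b≡4 b≤2))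
sum≡4 a+b≡4 (s≤s z≤n) b≤2 = ⊥-elim (<⇒≱ (s≤s (s≤s (s≤s z≤n))) (subst (_≤ 2) (suc-injective a+b≡4) b≤2))
sum≡4 a+b≡4 (s≤s (s≤s z≤n)) b≤2 = refl

sum≡3 : ∀ {a b} → a + b ≡ 3 → a ≤ 2 → b ≤ 2 → a ≡ 2 ⊎ b ≡ 2
sum≡3 a+b≡3 z≤n b≤2 = ⊥-elim (<⇒≱ (s≤s (s≤s (s≤s z≤n))) (subst (_≤ 2) a+b≡3 b≤2))
sum≡3 a+b≡3 (s≤s z≤n) b≤2 = inj₂ (suc-injective a+b≡3)
sum≡3 a+b≡3 (s≤s (s≤s z≤n)) b≤2 = inj₁ refl

module RankCalculus {n : ℕ} (M : Matroid n) where
  open Matroid M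

  r : Subset n → ℕ
  r = rank M

  indep≤rank : ∀ {X A} → Indep X → X ⊆ A → ∣ X ∣ ≤ r A
  indep≤rank {X} {A} X-indep X⊆A =
    maxList-upper _ (∈-map⁺ ∣_∣ (∈-filter⁺ (λ Y → (Y ⊆? A) ×-dec indep? Y)
                                            (allSubsets-complete X) (X⊆A , X-indep)))

  rank-witness : ∀ A → ∃[ I ] (Indep I × I ⊆ A × ∣ I ∣ ≡ r A)
  rank-witness A with maxList-attained (map ∣_∣ (filter (λ Y → (Y ⊆? A) ×-dec indep? Y) (allSubsets n)))
  ... | inj₁ r≡0 = ⊥ , I1-empty , ⊥⊆ , trans (∣⊥∣≡0 n) (sym r≡0)
  ... | inj₂ r∈ with ∈-map⁻ ∣_∣ r∈
  ...   | (I , I∈ , r≡∣I∣) with ∈-filter⁻ (λ Y → (Y ⊆? A) ×-dec indep? Y) {xs = allSubsets n} I∈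
  ...     | (_ , I⊆A , I-indep) = I , I-indep , I⊆A , sym r≡∣I∣

  rank-mono : ∀ {X Y} → X ⊆ Y → r X ≤ r Y
  rank-mono {X} {Y} X⊆Y with rank-witness X
  ... | (I , I-indep , I⊆X , ∣I∣≡rX) = subst (_≤ r Y) ∣I∣≡rX (indep≤rank I-indep (⊆-trans I⊆X X⊆Y))

  rank-gap-witness : ∀ {X Y} → r X < r Y → ∃[ e ] (e ∈ Y × e ∉ X)
  rank-gap-witness rX<rY = ∉-witness (λ Y⊆X → <⇒≱ rX<rY (rank-mono Y⊆X))

  rank-spanned : ∀ {I Y} → Indep I → I ⊆ Y → (∀ f → f ∈ Y → f ∉ I → ¬ Indep (I ∪ ⁅ f ⁆)) →
                 r Y ≡ ∣ I ∣
  rank-spanned {I} {Y} I-indep I⊆Y maximal with rank-witness Y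
  ... | (J , J-indep , J⊆Y , ∣J∣≡rY) = ≤-antisym (subst (_≤ ∣ I ∣) ∣J∣≡rY ∣J∣≤∣I∣) (indep≤rank I-indep I⊆Y)
    where
    ∣J∣≤∣I∣ : ∣ J ∣ ≤ ∣ I ∣
    ∣J∣≤∣I∣ with ∣ J ∣ ≤? ∣ I ∣
    ... | yes ∣J∣≤∣I∣ = ∣J∣≤∣I∣
    ... | no ∣J∣≰∣I∣ with I3-aug I-indep J-indep (≰⇒> ∣J∣≰∣I∣)
    ...   | (f , f∈J , f∉I , If-indep) = ⊥-elim (maximal f (J⊆Y f∈J) f∉I If-indep)

  rank-indep : ∀ {I} → Indep I → r I ≡ ∣ I ∣
  rank-indep I-indep = rank-spanned I-indep ⊆-refl (λ f f∈I f∉I _ → f∉I f∈I)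

  augment : ∀ {I X e} → Indep I → I ⊆ X → ∣ I ∣ ≡ r X → r X < r (X ∪ ⁅ e ⁆) → Indep (I ∪ ⁅ e ⁆)
  augment {I} {X} {e} I-indep I⊆X ∣I∣≡rX rX<rXe with rank-witness (X ∪ ⁅ e ⁆)
  ... | (J , J-indep , J⊆Xe , ∣J∣≡rXe)
      with I3-aug I-indep J-indep (subst₂ _<_ (sym ∣I∣≡rX) (sym ∣J∣≡rXe) rX<rXe)
  ...   | (f , f∈J , f∉I , If-indep) with x∈p∪q⁻ X ⁅ e ⁆ (J⊆Xe f∈J)
  ...     | inj₂ f∈⁅e⁆ = subst (λ z → Indep (I ∪ ⁅ z ⁆)) (x∈⁅y⁆⇒x≡y e f∈⁅e⁆) If-indep
  ...     | inj₁ f∈X = ⊥-elim (1+n≰n (subst₂ _≤_ (card-insert I f f∉I) (sym ∣I∣≡rX)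
                                        (indep≤rank If-indep (insert-⊆ I⊆X f∈X))))

  extend : ∀ {X Y} → Indep X → X ⊆ Y → ∃[ J ] (Indep J × X ⊆ J × J ⊆ Y × ∣ J ∣ ≡ r Y)
  extend {X} {Y} X-indep X⊆Y = go (r Y ∸ ∣ X ∣) X-indep X⊆Y (m∸n+n≡m (indep≤rank X-indep X⊆Y))
    where
    go : ∀ k {X} → Indep X → X ⊆ Y → k + ∣ X ∣ ≡ r Y →
         ∃[ J ] (Indep J × X ⊆ J × J ⊆ Y × ∣ J ∣ ≡ r Y)
    go zero {X} X-indep X⊆Y ∣X∣≡rY = X , X-indep , ⊆-refl , X⊆Y , ∣X∣≡rY
    go (suc k) {X} X-indep X⊆Y k+1+∣X∣≡rY with rank-witness Y
    ... | (I , I-indep , I⊆Y , ∣I∣≡rY)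
        with I3-aug X-indep I-indep (subst (∣ X ∣ <_) (sym ∣I∣≡rY)
                                      (≤-trans (s≤s (m≤n+m ∣ X ∣ k)) (≤-reflexive k+1+∣X∣≡rY)))
    ...   | (f , f∈I , f∉X , Xf-indep)
          with go k Xf-indep (insert-⊆ X⊆Y (I⊆Y f∈I))
                  (trans (cong (k +_) (card-insert X f f∉X)) (trans (+-suc k ∣ X ∣) k+1+∣X∣≡rY))
    ...     | (J , J-indep , Xf⊆J , J⊆Y , ∣J∣≡rY) =
              J , J-indep , (λ x∈X → Xf⊆J (∈-insert-old f x∈X)) , J⊆Y , ∣J∣≡rY

  base-card : ∀ {B} → IsBase M B → ∣ B ∣ ≡ r ⊤
  base-card {B} (B-indep , B-maximal) with extend B-indep ⊆⊤
  ... | (J , J-indep , B⊆J , _ , ∣J∣≡rE) = trans (cong ∣_∣ (sym (B-maximal J J-indep B⊆J))) ∣J∣≡rE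

  base-of-card : ∀ {B} → Indep B → ∣ B ∣ ≡ r ⊤ → IsBase M B
  base-of-card {B} B-indep ∣B∣≡rE =
    B-indep , λ Y Y-indep B⊆Y → card-antisym B⊆Y (subst (∣ Y ∣ ≤_) (sym ∣B∣≡rE) (indep≤rank Y-indep ⊆⊤))

  -- If a circuit C lies in X apart from p, then adding p does not raise the
  -- rank of X: a maximum independent subset of X containing C - p would
  -- otherwise extend by p to an independent superset of C.
  circuit-no-rank-gain : ∀ {C p X} → IsCircuit M C → p ∈ C → C - p ⊆ X → ¬ (r X < r (X ∪ ⁅ p ⁆))
  circuit-no-rank-gain {C} {p} {X} (C-dependent , C-minimal) p∈C C-p⊆X rX<rXp
    with extend (C-minimal (C - p) (x∈p⇒p-x⊂p p∈C)) C-p⊆X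
  ... | (J , J-indep , C-p⊆J , J⊆X , ∣J∣≡rX) =
    C-dependent (I2-down (augment J-indep J⊆X ∣J∣≡rX rX<rXp) C⊆Jp)
    where
    C⊆Jp : C ⊆ J ∪ ⁅ p ⁆
    C⊆Jp {q} q∈C with q ≟ᶠ p
    ... | yes refl = ∈-insert-new J q
    ... | no q≢p = ∈-insert-old p (C-p⊆J (x∈p∧x≢y⇒x∈p-y q∈C q≢p))

  trace≤rank : ∀ {B} F → Indep B → ∣ B ∩ F ∣ ≤ r F
  trace≤rank {B} F B-indep = indep≤rank (I2-down B-indep (p∩q⊆p B F)) (p∩q⊆q B F)

  rank2-no-indep-triple : ∀ {L a e f} → r L ≡ 2 → (⁅ a ⁆ ∪ ⁅ e ⁆) ∪ ⁅ f ⁆ ⊆ L → e ≢ a →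
                          f ∉ ⁅ a ⁆ ∪ ⁅ e ⁆ → ¬ Indep ((⁅ a ⁆ ∪ ⁅ e ⁆) ∪ ⁅ f ⁆)
  rank2-no-indep-triple {L} {a} {e} {f} rL≡2 aef⊆L e≢a f∉ae aef-indep =
    1+n≰n (subst₂ _≤_ (trans (card-insert (⁅ a ⁆ ∪ ⁅ e ⁆) f f∉ae) (cong suc (card-pair a e e≢a))) rL≡2
                      (indep≤rank aef-indep aef⊆L))

  cl : Subset n → Subset n
  cl P = select (λ e → r (P ∪ ⁅ e ⁆) ≟ r P)

  cl-in : ∀ {P e} → r (P ∪ ⁅ e ⁆) ≡ r P → e ∈ cl P
  cl-in {P} = ∈-select⁺ (λ e → r (P ∪ ⁅ e ⁆) ≟ r P)

  cl-out : ∀ {P e} → e ∈ cl P → r (P ∪ ⁅ e ⁆) ≡ r P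
  cl-out {P} = ∈-select⁻ (λ e → r (P ∪ ⁅ e ⁆) ≟ r P)

  ⊆-cl : ∀ {P} → P ⊆ cl P
  ⊆-cl {P} {e} e∈P = cl-in (cong r (⊆-antisym (insert-⊆ ⊆-refl e∈P) (p⊆p∪q ⁅ e ⁆)))

  ∉cl⇒indep : ∀ {P e} → Indep P → e ∉ cl P → Indep (P ∪ ⁅ e ⁆)
  ∉cl⇒indep {P} {e} P-indep e∉cl =
    augment P-indep ⊆-refl (sym (rank-indep P-indep))
            (≤∧≢⇒< (rank-mono (p⊆p∪q ⁅ e ⁆)) (λ rP≡rPe → e∉cl (cl-in (sym rP≡rPe))))

  cl-rank : ∀ {P} → Indep P → r (cl P) ≡ ∣ P ∣
  cl-rank {P} P-indep = rank-spanned P-indep ⊆-cl no-extension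
    where
    no-extension : ∀ f → f ∈ cl P → f ∉ P → ¬ Indep (P ∪ ⁅ f ⁆)
    no-extension f f∈cl f∉P Pf-indep =
      1+n≰n (subst₂ _≤_ (card-insert P f f∉P) (trans (cl-out f∈cl) (rank-indep P-indep))
                        (indep≤rank Pf-indep ⊆-refl))

  cl-flat : ∀ {P} → Indep P → IsFlat M (cl P)
  cl-flat {P} P-indep e e∉cl = begin-strict
    r (cl P)          ≡⟨ cl-rank P-indep ⟩
    ∣ P ∣             <⟨ n<1+n ∣ P ∣ ⟩
    suc ∣ P ∣         ≡⟨ card-insert P e (λ e∈P → e∉cl (⊆-cl e∈P)) ⟨
    ∣ P ∪ ⁅ e ⁆ ∣     ≤⟨ indep≤rank (∉cl⇒indep P-indep e∉cl) P+e⊆cl+e ⟩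
    r (cl P ∪ ⁅ e ⁆)  ∎
    where
    open ≤-Reasoning
    P+e⊆cl+e : P ∪ ⁅ e ⁆ ⊆ cl P ∪ ⁅ e ⁆
    P+e⊆cl+e = insert-⊆ (λ x∈P → ∈-insert-old e (⊆-cl x∈P)) (∈-insert-new (cl P) e)

  dependent⇒∈cl : ∀ {P e} → Indep P → ¬ Indep (P ∪ ⁅ e ⁆) → e ∈ cl P
  dependent⇒∈cl {P} {e} P-indep Pe-dependent with e ∈? cl P
  ... | yes e∈cl = e∈cl
  ... | no e∉cl = ⊥-elim (Pe-dependent (∉cl⇒indep P-indep e∉cl))

module RankThree {n : ℕ} (M : Matroid n) (connected : Connected M) (rE≡3 : rank M ⊤ ≡ 3)
                 (A : Subset n) (A-flat : IsFlat M A) (rA≡1 : rank M A ≡ 1) where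
  open Matroid M
  open RankCalculus M

  FaceOf : Subset n → Family M
  FaceOf S = Face M (S ∷ [])

  FaceA : Family M
  FaceA = FaceOf A

  ∈FaceOf : ∀ {S B} → IsBase M B → ∣ B ∩ S ∣ ≡ r S → FaceOf S B
  ∈FaceOf B-base ∣B∩S∣≡rS = B-base , (∣B∩S∣≡rS All.∷ All.[])

  FaceOf-trace : ∀ {S B} → FaceOf S B → ∣ B ∩ S ∣ ≡ r S
  FaceOf-trace (_ , (∣B∩S∣≡rS All.∷ All.[])) = ∣B∩S∣≡rS

  Splitting : Subset n → Subset n → Set
  Splitting F₁ F₂ = IsFlat M F₁ × IsFlat M F₂ × rank M F₁ ≡ 2 × rank M F₂ ≡ 2
                    × A ≡ F₁ ∩ F₂ × F₁ ∪ F₂ ≡ ⊤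

  A-pair-dependent : ∀ {x y} → x ∈ A → y ∈ A → y ≢ x → ¬ Indep (⁅ x ⁆ ∪ ⁅ y ⁆)
  A-pair-dependent {x} {y} x∈A y∈A y≢x xy-indep =
    1+n≰n (subst₂ _≤_ (card-pair x y y≢x) rA≡1 (indep≤rank xy-indep (pair-⊆ x∈A y∈A)))

  base-meets-A : ∀ {B} → IsBase M B → ∣ B ∩ A ∣ ≡ 0 ⊎ ∣ B ∩ A ∣ ≡ 1
  base-meets-A (B-indep , _) = ≤1-cases (subst (_ ≤_) rA≡1 (trace≤rank A B-indep))

  -- Connectivity puts A in the closure of its complement: a circuit through
  -- x ∈ A and a point outside A meets A only in x.
  complement-spans-A : ∀ {x} → x ∈ A → ¬ (r (∁ A) < r (∁ A ∪ ⁅ x ⁆))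
  complement-spans-A {x} x∈A with rank-gap-witness {A} {⊤} (subst₂ _<_ (sym rA≡1) (sym rE≡3) (s≤s (s≤s z≤n)))
  ... | (e , _ , e∉A) with connected x e (λ { refl → e∉A x∈A })
  ...   | (C , C-circuit , x∈C , e∈C) = circuit-no-rank-gain C-circuit x∈C (remove-⊆ C-x⊆∁A)
    where
    C-x⊆∁A : ∀ {q} → q ∈ C → q ≢ x → q ∈ ∁ A
    C-x⊆∁A {q} q∈C q≢x with q ∈? A
    ... | no q∉A = x∉p⇒x∈∁p q∉A
    ... | yes q∈A = ⊥-elim (A-pair-dependent x∈A q∈A q≢x
                      (proj₂ C-circuit (⁅ x ⁆ ∪ ⁅ q ⁆)
                        (pair-⊆ x∈C q∈C , e , e∈C , ∉-pair (λ { refl → e∉A x∈A }) (λ { refl → e∉A q∈A }))))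

  -- Hence some base avoids A: a maximum independent subset I of ∁ A is a base,
  -- since no element of a base J ⊇ I can lie outside I.
  base-avoiding-A : ∃[ D ] (IsBase M D × ∣ D ∩ A ∣ ≡ 0)
  base-avoiding-A with rank-witness (∁ A)
  ... | (I , I-indep , I⊆∁A , ∣I∣≡r∁A) with extend I-indep (⊆⊤ {p = I})
  ...   | (J , J-indep , I⊆J , _ , ∣J∣≡rE) =
    I , subst (IsBase M) (⊆-antisym J⊆I I⊆J) (base-of-card J-indep ∣J∣≡rE) ,
    card0-empty (λ x∈I∩A → x∈∁p⇒x∉p (I⊆∁A (p∩q⊆p I A x∈I∩A)) (p∩q⊆q I A x∈I∩A))
    where
    rank-jump : ∀ {x} → x ∈ J → x ∉ I → r (∁ A) < r (∁ A ∪ ⁅ x ⁆)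
    rank-jump {x} x∈J x∉I =
      subst₂ _≤_ (trans (card-insert I x x∉I) (cong suc ∣I∣≡r∁A)) refl
        (indep≤rank (I2-down J-indep (insert-⊆ I⊆J x∈J))
                    (insert-⊆ (λ y∈I → ∈-insert-old x (I⊆∁A y∈I)) (∈-insert-new (∁ A) x)))
    J⊆I : J ⊆ I
    J⊆I {x} x∈J with x ∈? I
    ... | yes x∈I = x∈I
    ... | no x∉I with x ∈? A
    ...   | yes x∈A = ⊥-elim (complement-spans-A x∈A (rank-jump x∈J x∉I))
    ...   | no x∉A = ⊥-elim (<⇒≱ (rank-jump x∈J x∉I) (rank-mono (insert-⊆ ⊆-refl (x∉p⇒x∈∁p x∉A))))

  FaceA-proper : Proper M FaceA
  FaceA-proper all-in-FaceA =
    let (D , D-base , ∣D∩A∣≡0) = base-avoiding-A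
    in 0≢1+n (trans (sym ∣D∩A∣≡0) (trans (FaceOf-trace (all-in-FaceA D D-base)) rA≡1))

  module SplitFaces {F₁ F₂ : Subset n} (F₁-flat : IsFlat M F₁) (F₂-flat : IsFlat M F₂)
                    (rF₁≡2 : r F₁ ≡ 2) (rF₂≡2 : r F₂ ≡ 2)
                    (A≡F₁∩F₂ : A ≡ F₁ ∩ F₂) (F₁∪F₂≡E : F₁ ∪ F₂ ≡ ⊤) where

    base-trace-sum : ∀ {B} → IsBase M B → ∣ B ∩ F₁ ∣ + ∣ B ∩ F₂ ∣ ≡ 3 + ∣ B ∩ A ∣
    base-trace-sum {B} B-base = begin
      ∣ B ∩ F₁ ∣ + ∣ B ∩ F₂ ∣               ≡⟨ inclusion-exclusion B F₁ F₂ ⟩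
      ∣ B ∩ (F₁ ∪ F₂) ∣ + ∣ B ∩ (F₁ ∩ F₂) ∣ ≡⟨ cong₂ (λ U V → ∣ B ∩ U ∣ + ∣ B ∩ V ∣) F₁∪F₂≡E (sym A≡F₁∩F₂) ⟩
      ∣ B ∩ ⊤ ∣ + ∣ B ∩ A ∣                 ≡⟨ cong (λ Z → ∣ Z ∣ + ∣ B ∩ A ∣) (∩-identityʳ B) ⟩
      ∣ B ∣ + ∣ B ∩ A ∣                     ≡⟨ cong (_+ ∣ B ∩ A ∣) (trans (base-card B-base) rE≡3) ⟩
      3 + ∣ B ∩ A ∣                         ∎
      where open ≡-Reasoning

    trace≤2 : ∀ {B F} → IsBase M B → r F ≡ 2 → ∣ B ∩ F ∣ ≤ 2
    trace≤2 {F = F} (B-indep , _) rF≡2 = subst (_ ≤_) rF≡2 (trace≤rank F B-indep)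

    -- A base meeting A once meets both lines twice.
    FaceA⊆FaceF₁ : _⊆ᶠ_ M FaceA (FaceOf F₁)
    FaceA⊆FaceF₁ B (B-base , (∣B∩A∣≡rA All.∷ All.[])) =
      ∈FaceOf B-base (trans (sum≡4 (trans (base-trace-sum B-base) (cong (3 +_) (trans ∣B∩A∣≡rA rA≡1)))
                                   (trace≤2 B-base rF₁≡2) (trace≤2 B-base rF₂≡2))
                            (sym rF₁≡2))

    -- A base avoiding A meets one of the lines twice.
    base-in-some-face : ∀ {B} → IsBase M B → FaceA B ⊎ FaceOf F₁ B ⊎ FaceOf F₂ B
    base-in-some-face {B} B-base with base-meets-A B-base
    ... | inj₂ ∣B∩A∣≡1 = inj₁ (∈FaceOf B-base (trans ∣B∩A∣≡1 (sym rA≡1)))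
    ... | inj₁ ∣B∩A∣≡0
        with sum≡3 (trans (base-trace-sum B-base) (cong (3 +_) ∣B∩A∣≡0))
                   (trace≤2 B-base rF₁≡2) (trace≤2 B-base rF₂≡2)
    ...   | inj₁ ∣B∩F₁∣≡2 = inj₂ (inj₁ (∈FaceOf B-base (trans ∣B∩F₁∣≡2 (sym rF₁≡2))))
    ...   | inj₂ ∣B∩F₂∣≡2 = inj₂ (inj₂ (∈FaceOf B-base (trans ∣B∩F₂∣≡2 (sym rF₂≡2))))

    ∈F₁∩F₂⇒∈A : ∀ {x} → x ∈ F₁ → x ∈ F₂ → x ∈ A
    ∈F₁∩F₂⇒∈A x∈F₁ x∈F₂ = subst (_ ∈_) (sym A≡F₁∩F₂) (x∈p∩q⁺ (x∈F₁ , x∈F₂))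

    ∉A⇒∉F₁ : ∀ {x} → x ∈ F₂ → x ∉ A → x ∉ F₁
    ∉A⇒∉F₁ x∈F₂ x∉A x∈F₁ = x∉A (∈F₁∩F₂⇒∈A x∈F₁ x∈F₂)

    ∉A⇒∉F₂ : ∀ {x} → x ∈ F₁ → x ∉ A → x ∉ F₂
    ∉A⇒∉F₂ x∈F₁ x∉A x∈F₂ = x∉A (∈F₁∩F₂⇒∈A x∈F₁ x∈F₂)

    ∈F₁∪F₂ : ∀ x → x ∈ F₁ ⊎ x ∈ F₂
    ∈F₁∪F₂ x = x∈p∪q⁻ F₁ F₂ (subst (x ∈_) (sym F₁∪F₂≡E) ∈⊤)

    off-A : ∀ {F} → r F ≡ 2 → ∃[ x ] (x ∈ F × x ∉ A)
    off-A rF≡2 = rank-gap-witness (subst₂ _<_ (sym rA≡1) (sym rF≡2) (s≤s (s≤s z≤n)))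

    -- Take f ∈ F₁ ∖ A, p ∈ F₂ ∖ A and a circuit C
    -- through p and f.  As F₁ is a flat missing p, some q ∈ C - p lies
    -- outside F₁, hence in F₂; the pair {p, q} ⊂ C is independent and spans
    -- the line F₂, so adding f ∉ F₂ gives a base {p, q, f}.
    base-meeting-F₁-once : ∃[ B ] (IsBase M B × ∣ B ∩ F₁ ∣ ≡ 1)
    base-meeting-F₁-once with off-A rF₁≡2 | off-A rF₂≡2
    ... | (f , f∈F₁ , f∉A) | (p , p∈F₂ , p∉A) with connected p f (λ { refl → p∉A (∈F₁∩F₂⇒∈A f∈F₁ p∈F₂) })
    ...   | (C , C-circuit , p∈C , f∈C)
          with ∉-witness {p = F₁} {q = C - p} (λ C-p⊆F₁ → circuit-no-rank-gain C-circuit p∈C C-p⊆F₁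
                                        (F₁-flat p (λ p∈F₁ → p∉A (∈F₁∩F₂⇒∈A p∈F₁ p∈F₂))))
    ...     | (q , q∈C-p , q∉F₁) = (pq ∪ ⁅ f ⁆) , pqf-base , pqf-trace
      where
      pq : Subset n
      pq = ⁅ p ⁆ ∪ ⁅ q ⁆
      q∈C : q ∈ C
      q∈C = proj₁ (∈-remove⁻ q∈C-p)
      q≢p : q ≢ p
      q≢p = proj₂ (∈-remove⁻ q∈C-p)
      p∉F₁ : p ∉ F₁
      p∉F₁ = ∉A⇒∉F₁ p∈F₂ p∉A
      q∈F₂ : q ∈ F₂
      q∈F₂ with ∈F₁∪F₂ q
      ... | inj₁ q∈F₁ = ⊥-elim (q∉F₁ q∈F₁)
      ... | inj₂ q∈F₂ = q∈F₂
      f∉F₂ : f ∉ F₂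
      f∉F₂ = ∉A⇒∉F₂ f∈F₁ f∉A
      f∉pq : f ∉ pq
      f∉pq = ∉-pair (λ { refl → p∉F₁ f∈F₁ }) (λ { refl → q∉F₁ f∈F₁ })
      pq-indep : Indep pq
      pq-indep = proj₂ C-circuit pq (pair-⊆ p∈C q∈C , f , f∈C , f∉pq)
      pqf-base : IsBase M (pq ∪ ⁅ f ⁆)
      pqf-base = base-of-card
        (augment pq-indep (pair-⊆ p∈F₂ q∈F₂) (trans (card-pair p q q≢p) (sym rF₂≡2)) (F₂-flat f f∉F₂))
        (trans (card-insert pq f f∉pq) (trans (cong suc (card-pair p q q≢p)) (sym rE≡3)))
      pqf-trace : ∣ (pq ∪ ⁅ f ⁆) ∩ F₁ ∣ ≡ 1
      pqf-trace = trans (card-insert-∈ pq F₁ f f∉pq f∈F₁)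
                        (cong suc (trans (card-insert-∉ ⁅ p ⁆ F₁ q q∉F₁) (card-⁅⁆∩-∉ p F₁ p∉F₁)))

    FaceF₁-proper : Proper M (FaceOf F₁)
    FaceF₁-proper all-in-FaceF₁ =
      let (B , B-base , ∣B∩F₁∣≡1) = base-meeting-F₁-once
      in 1+n≢n (trans (sym rF₁≡2) (trans (sym (FaceOf-trace (all-in-FaceF₁ B B-base))) ∣B∩F₁∣≡1))

  -- (⇒) By maximality the proper faces of F₁ and F₂, which contain the face of
  -- A, collapse onto it; as every base lies in one of the three faces, the face
  -- of A would not be proper.
  facet⇒unsplittable : FacetDefining M A → ¬ (∃[ F₁ ] ∃[ F₂ ] Splitting F₁ F₂)
  facet⇒unsplittable (_ , FaceA-proper′ , FaceA-maximal)
                     (F₁ , F₂ , F₁-flat , F₂-flat , rF₁≡2 , rF₂≡2 , A≡F₁∩F₂ , F₁∪F₂≡E) =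
    FaceA-proper′ all-in-FaceA
    where
    open SplitFaces F₁-flat F₂-flat rF₁≡2 rF₂≡2 A≡F₁∩F₂ F₁∪F₂≡E
    module Swapped = SplitFaces F₂-flat F₁-flat rF₂≡2 rF₁≡2
                       (trans A≡F₁∩F₂ (∩-comm F₁ F₂)) (trans (∪-comm F₂ F₁) F₁∪F₂≡E)
    all-in-FaceA : _⊆ᶠ_ M (IsBase M) FaceA
    all-in-FaceA B B-base with base-in-some-face B-base
    ... | inj₁ in-FaceA = in-FaceA
    ... | inj₂ (inj₁ in-FaceF₁) = FaceA-maximal (F₁ ∷ []) FaceF₁-proper FaceA⊆FaceF₁ B in-FaceF₁
    ... | inj₂ (inj₂ in-FaceF₂) =
          FaceA-maximal (F₂ ∷ []) Swapped.FaceF₁-proper Swapped.FaceA⊆FaceF₁ B in-FaceF₂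

  avoids-A : ∀ {V v} → ∣ V ∩ A ∣ ≡ 0 → v ∈ V → v ∉ A
  avoids-A ∣V∩A∣≡0 v∈V v∈A = card0-∉ ∣V∩A∣≡0 (x∈p∩q⁺ (v∈V , v∈A))

  non-loop-in-A : ∃[ a ] (a ∈ A × Indep ⁅ a ⁆)
  non-loop-in-A with rank-witness A
  ... | (I , I-indep , I⊆A , ∣I∣≡rA)
      with larger-witness {p = ⊥} {q = I} (subst₂ _<_ (sym (∣⊥∣≡0 n)) (sym (trans ∣I∣≡rA rA≡1)) (s≤s z≤n))
  ...   | (a , a∈I , _) = a , I⊆A a∈I , I2-down I-indep (⁅⁆-⊆ a∈I)

  module Lines {a : Fin n} (a∈A : a ∈ A) (a-indep : Indep ⁅ a ⁆) where

    pair : Fin n → Subset n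
    pair y = ⁅ a ⁆ ∪ ⁅ y ⁆

    line : Fin n → Subset n
    line y = cl (pair y)

    ∉A⇒≢a : ∀ {y} → y ∉ A → y ≢ a
    ∉A⇒≢a y∉A refl = y∉A a∈A

    a∈pair : ∀ y → a ∈ pair y
    a∈pair y = x∈p∪q⁺ (inj₁ (x∈⁅x⁆ a))

    -- As A is a flat, {a, y} is independent for y ∉ A.
    pair-indep : ∀ {y} → y ∉ A → Indep (pair y)
    pair-indep y∉A = augment a-indep (⁅⁆-⊆ a∈A) (trans (∣⁅x⁆∣≡1 a) (sym rA≡1)) (A-flat _ y∉A)

    line-rank : ∀ {y} → y ∉ A → r (line y) ≡ 2
    line-rank {y} y∉A = trans (cl-rank (pair-indep y∉A)) (card-pair a y (∉A⇒≢a y∉A))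

    line-flat : ∀ {y} → y ∉ A → IsFlat M (line y)
    line-flat y∉A = cl-flat (pair-indep y∉A)

    -- Every point of A is dependent on a, so the line contains A.
    A⊆line : ∀ {y} → y ∉ A → A ⊆ line y
    A⊆line {y} y∉A {e} e∈A with e ≟ᶠ a
    ... | yes refl = ⊆-cl (a∈pair y)
    ... | no e≢a = dependent⇒∈cl (pair-indep y∉A) λ pair+e-indep →
          A-pair-dependent a∈A e∈A e≢a
            (I2-down pair+e-indep (pair-⊆ (∈-insert-old e (a∈pair y)) (∈-insert-new (pair y) e)))

    -- Two lines covering E meet exactly in A: a common point e ∉ A would make
    -- {a, e} span both lines, so E would have rank 2.
    lines-meet-in-A : ∀ {y z} → y ∉ A → z ∉ A → line y ∪ line z ≡ ⊤ → line y ∩ line z ⊆ A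
    lines-meet-in-A {y} {z} y∉A z∉A cover {e} e∈∩ with e ∈? A
    ... | yes e∈A = e∈A
    ... | no e∉A = ⊥-elim (<⇒≢ (s≤s (s≤s (s≤s z≤n))) (trans (sym rE≡2) rE≡3))
      where
      e∈line-y : e ∈ line y
      e∈line-y = proj₁ (x∈p∩q⁻ (line y) (line z) e∈∩)
      e∈line-z : e ∈ line z
      e∈line-z = proj₂ (x∈p∩q⁻ (line y) (line z) e∈∩)
      no-extension : ∀ f → f ∈ line y ∪ line z → f ∉ pair e → ¬ Indep (pair e ∪ ⁅ f ⁆)
      no-extension f f∈ f∉ae with x∈p∪q⁻ (line y) (line z) f∈
      ... | inj₁ f∈line-y = rank2-no-indep-triple (line-rank y∉A)
              (insert-⊆ (pair-⊆ (A⊆line y∉A a∈A) e∈line-y) f∈line-y) (∉A⇒≢a e∉A) f∉ae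
      ... | inj₂ f∈line-z = rank2-no-indep-triple (line-rank z∉A)
              (insert-⊆ (pair-⊆ (A⊆line z∉A a∈A) e∈line-z) f∈line-z) (∉A⇒≢a e∉A) f∉ae
      rE≡2 : r ⊤ ≡ 2
      rE≡2 = subst (λ X → r X ≡ 2) cover
        (trans (rank-spanned (pair-indep e∉A)
                  (pair-⊆ (x∈p∪q⁺ (inj₁ (A⊆line y∉A a∈A))) (x∈p∪q⁺ (inj₁ e∈line-y))) no-extension)
               (card-pair a e (∉A⇒≢a e∉A)))

    lines-miss-a-point : ¬ (∃[ F₁ ] ∃[ F₂ ] Splitting F₁ F₂) → ∀ {y z} → y ∉ A → z ∉ A →
                         ∃[ x ] (x ∉ line y × x ∉ line z)
    lines-miss-a-point unsplittable {y} {z} y∉A z∉A = miss-both (∉-witness E⊈lines)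
      where
      E⊈lines : ¬ (⊤ ⊆ line y ∪ line z)
      E⊈lines E⊆lines = unsplittable (line y , line z , line-flat y∉A , line-flat z∉A ,
                                      line-rank y∉A , line-rank z∉A , A≡∩ , cover)
        where
        cover : line y ∪ line z ≡ ⊤
        cover = ⊆-antisym ⊆⊤ E⊆lines
        A≡∩ : A ≡ line y ∩ line z
        A≡∩ = ⊆-antisym (λ e∈A → x∈p∩q⁺ (A⊆line y∉A e∈A , A⊆line z∉A e∈A))
                        (lines-meet-in-A y∉A z∉A cover)
      miss-both : ∃[ x ] (x ∈ ⊤ × x ∉ line y ∪ line z) → ∃[ x ] (x ∉ line y × x ∉ line z)
      miss-both (x , _ , x∉lines) = x , (λ x∈ → x∉lines (x∈p∪q⁺ (inj₁ x∈))) , (λ x∈ → x∉lines (x∈p∪q⁺ (inj₂ x∈)))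

    base-through : ∀ {x y} → y ∉ A → x ∉ line y → FaceA ((⁅ a ⁆ ∪ ⁅ x ⁆) ∪ ⁅ y ⁆)
    base-through {x} {y} y∉A x∉line = ∈FaceOf (subst (IsBase M) (insert-comm ⁅ a ⁆ x y) axy-base) axy-trace
      where
      x∉pair : x ∉ pair y
      x∉pair x∈ = x∉line (⊆-cl x∈)
      axy-base : IsBase M (pair y ∪ ⁅ x ⁆)
      axy-base = base-of-card (∉cl⇒indep (pair-indep y∉A) x∉line)
        (trans (card-insert (pair y) x x∉pair) (trans (cong suc (card-pair a y (∉A⇒≢a y∉A))) (sym rE≡3)))
      axy-trace : ∣ ((⁅ a ⁆ ∪ ⁅ x ⁆) ∪ ⁅ y ⁆) ∩ A ∣ ≡ r A
      axy-trace = trans (card-insert-∉ (⁅ a ⁆ ∪ ⁅ x ⁆) A y y∉A)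
        (trans (card-insert-∉ ⁅ a ⁆ A x (λ x∈A → x∉line (A⊆line y∉A x∈A)))
               (trans (card-⁅⁆∩-∈ a A a∈A) (sym rA≡1)))

    -- Without a splitting pair, a set S tight on the face of A contains all
    -- or none of E ∖ A: for y ∈ S, z ∉ S off A, and x off both lines through
    -- a, the bases {a, x, y} and {a, x, z} of that face differ in their trace on S.
    tight-all-or-none : ¬ (∃[ F₁ ] ∃[ F₂ ] Splitting F₁ F₂) → ∀ {S} → _⊆ᶠ_ M FaceA (FaceOf S) →
                        ∀ {y z} → y ∉ A → z ∉ A → y ∈ S → z ∈ S
    tight-all-or-none unsplittable {S} tight {y} {z} y∉A z∉A y∈S with z ∈? S
    ... | yes z∈S = z∈S
    ... | no z∉S = ⊥-elim (no-common-miss (lines-miss-a-point unsplittable y∉A z∉A))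
      where
      no-common-miss : ¬ (∃[ x ] (x ∉ line y × x ∉ line z))
      no-common-miss (x , x∉line-y , x∉line-z) = 1+n≢n (trans (sym trace-y) trace-z)
        where
        ax : Subset n
        ax = ⁅ a ⁆ ∪ ⁅ x ⁆
        y∉ax : y ∉ ax
        y∉ax = ∉-pair (∉A⇒≢a y∉A) (λ { refl → x∉line-y (⊆-cl (x∈p∪q⁺ (inj₂ (x∈⁅x⁆ y)))) })
        trace-y : ∣ (ax ∪ ⁅ y ⁆) ∩ S ∣ ≡ suc ∣ ax ∩ S ∣
        trace-y = card-insert-∈ ax S y y∉ax y∈S
        trace-z : ∣ (ax ∪ ⁅ y ⁆) ∩ S ∣ ≡ ∣ ax ∩ S ∣
        trace-z = begin
          ∣ (ax ∪ ⁅ y ⁆) ∩ S ∣ ≡⟨ FaceOf-trace (tight _ (base-through y∉A x∉line-y)) ⟩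
          r S                  ≡⟨ FaceOf-trace (tight _ (base-through z∉A x∉line-z)) ⟨
          ∣ (ax ∪ ⁅ z ⁆) ∩ S ∣ ≡⟨ card-insert-∉ ax S z z∉S ⟩
          ∣ ax ∩ S ∣           ∎
          where open ≡-Reasoning

    avoiding-bases-agree : ¬ (∃[ F₁ ] ∃[ F₂ ] Splitting F₁ F₂) → ∀ {S} → _⊆ᶠ_ M FaceA (FaceOf S) →
                           ∀ {X W} → IsBase M X → ∣ X ∩ A ∣ ≡ 0 → IsBase M W → ∣ W ∩ A ∣ ≡ 0 →
                           ∣ X ∩ S ∣ ≡ ∣ W ∩ S ∣
    avoiding-bases-agree unsplittable {S} tight {X} {W} X-base ∣X∩A∣≡0 W-base ∣W∩A∣≡0
      with any? (λ e → ¬? (e ∈? A) ×-dec (e ∈? S))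
    ... | yes (e , e∉A , e∈S) = trans (trace-all X-base ∣X∩A∣≡0) (sym (trace-all W-base ∣W∩A∣≡0))
      where
      -- all of E ∖ A lies in S, so such a base lies in S
      trace-all : ∀ {V} → IsBase M V → ∣ V ∩ A ∣ ≡ 0 → ∣ V ∩ S ∣ ≡ 3
      trace-all {V} V-base ∣V∩A∣≡0 =
        trans (cong ∣_∣ (⊆-antisym (p∩q⊆p V S) V⊆V∩S)) (trans (base-card V-base) rE≡3)
        where
        V⊆V∩S : V ⊆ V ∩ S
        V⊆V∩S v∈V = x∈p∩q⁺ (v∈V , tight-all-or-none unsplittable tight e∉A (avoids-A ∣V∩A∣≡0 v∈V) e∈S)
    ... | no no-point = trans (trace-none {X} ∣X∩A∣≡0) (sym (trace-none {W} ∣W∩A∣≡0))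
      where
      -- S misses E ∖ A, so such a base misses S
      trace-none : ∀ {V} → ∣ V ∩ A ∣ ≡ 0 → ∣ V ∩ S ∣ ≡ 0
      trace-none {V} ∣V∩A∣≡0 = card0-empty λ v∈V∩S →
        let (v∈V , v∈S) = x∈p∩q⁻ V S v∈V∩S in no-point (_ , avoids-A ∣V∩A∣≡0 v∈V , v∈S)

    -- (⇐) Maximality: a proper face containing the face of A contains no base
    -- X avoiding A, as otherwise every set defining it would be tight on all bases.
    FaceA-maximal : ¬ (∃[ F₁ ] ∃[ F₂ ] Splitting F₁ F₂) →
                    ∀ Bs → Proper M (Face M Bs) → _⊆ᶠ_ M FaceA (Face M Bs) → _⊆ᶠ_ M (Face M Bs) FaceA
    FaceA-maximal unsplittable Bs Bs-proper FaceA⊆Bs X (X-base , X-traces) with base-meets-A X-base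
    ... | inj₂ ∣X∩A∣≡1 = ∈FaceOf X-base (trans ∣X∩A∣≡1 (sym rA≡1))
    ... | inj₁ ∣X∩A∣≡0 = ⊥-elim (Bs-proper λ W W-base → W-base , All.tabulate (tight-on W-base))
      where
      tight-on : ∀ {W} → IsBase M W → ∀ {S} → S List.∈ Bs → ∣ W ∩ S ∣ ≡ r S
      tight-on {W} W-base {S} S∈Bs with base-meets-A W-base
      ... | inj₂ ∣W∩A∣≡1 = All.lookup (proj₂ (FaceA⊆Bs W (∈FaceOf W-base (trans ∣W∩A∣≡1 (sym rA≡1))))) S∈Bs
      ... | inj₁ ∣W∩A∣≡0 =
            trans (sym (avoiding-bases-agree unsplittable tight X-base ∣X∩A∣≡0 W-base ∣W∩A∣≡0))
                  (All.lookup X-traces S∈Bs)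
        where
        tight : _⊆ᶠ_ M FaceA (FaceOf S)
        tight B B∈FaceA = let (B-base , B-traces) = FaceA⊆Bs B B∈FaceA
                          in ∈FaceOf B-base (All.lookup B-traces S∈Bs)

  unsplittable⇒facet : ¬ (∃[ F₁ ] ∃[ F₂ ] Splitting F₁ F₂) → FacetDefining M A
  unsplittable⇒facet unsplittable =
    ((A ∷ []) , (λ _ B∈FaceA → B∈FaceA) , (λ _ B∈FaceA → B∈FaceA)) , FaceA-proper ,
    Lines.FaceA-maximal (proj₁ (proj₂ non-loop-in-A)) (proj₂ (proj₂ non-loop-in-A)) unsplittable

corollary4p3 : (n : ℕ) (M : Matroid n) → Connected M → rank M ⊤ ≡ 3 →
    (A : Subset n) → IsFlat M A → rank M A ≡ 1 →
    FacetDefining M A ⇔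
      (¬ (∃[ F₁ ] ∃[ F₂ ] (IsFlat M F₁ × IsFlat M F₂ × rank M F₁ ≡ 2 × rank M F₂ ≡ 2
          × A ≡ F₁ ∩ F₂ × F₁ ∪ F₂ ≡ ⊤)))
corollary4p3 n M connected rE≡3 A A-flat rA≡1 = mk⇔ facet⇒unsplittable unsplittable⇒facet
  where open RankThree M connected rE≡3 A A-flat rA≡1
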